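{- Let $D \neq 1$ be a square-free integer, let $p$ be an odd prime, let $k,\ell$ be positive integers, and let $c_D$ be a positive integer with $\gcd(c_D k, p) = 1$. Let $N = c_D k p^\ell - 1$, and assume $N$ is odd and the Jacobi symbol satisfies $\left(\frac{D}{N}\right) = -1$. Let $w \in \mathcal{G}_N(D)$. Suppose there exists an integer $j$ with $1 \le j \le \ell$ such that (i) $\Phi_p\bigl(w^{c_D k p^{j-1}}\bigr) \equiv 0 \pmod N$, and (ii) $2j \ge \log_p(c_D k) + \ell$. Then $N$ is prime. Here $\Phi_p(x) = x^{p-1} + \dots + x + 1$ is the $p$-th cyclotomic polynomial.
   Context: For an integer $n \ge 2$ and square-free $D \neq 1$: if $D \equiv 2,3 \pmod 4$, let $\mathcal{I}_n(D) = \{a + b\sqrt{D} : a,b \in \mathbb{Z}/n\mathbb{Z}\}$ (the ring $\mathbb{Z}[\sqrt D]/n\mathbb{Z}[\sqrt D]$) and $\mathcal{G}_n(D) = \{a + b\sqrt{D} \in \mathcal{I}_n(D) : a^2 - Db^2 \equiv 1 \pmod n\}$. If $D \equiv 1 \pmod 4$, let $\omega = \frac{1+\sqrt D}{2}$, $\mathcal{I}_n(D) = \{a + b\omega : a,b \in \mathbb{Z}/n\mathbb{Z}\}$ (the ring $\mathbb{Z}[\omega]/n\mathbb{Z}[\omega]$) and $\mathcal{G}_n(D) = \{a + b\omega \in \mathcal{I}_n(D) : a^2 + ab + \frac{1-D}{4} b^2 \equiv 1 \pmod n\}$. $\mathcal{G}_n(D)$ is a group under the multiplication of $\mathcal{I}_n(D)$.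 A congruence $x \equiv y \pmod n$ between elements of $\mathcal{I}_n(D)$ means $x = y$ in $\mathcal{I}_n(D)$. -}

module Defs where

open import Data.Nat as ℕ using (ℕ; zero; suc)
open import Data.Nat.Primality using (Prime)
open import Data.Integer as ℤ using (ℤ; +_; -_; _+_; _-_; _*_; _%_; _/_)
open import Data.Integer.Divisibility using (_∣_)
open import Data.Product using (_×_; _,_; Σ; ∃)
open import Data.List using (List; map; upTo; foldr; _∷_; [])
open import Data.List.Relation.Unary.All as All using (All)
open import Data.List.Relation.Unary.Any using (any?)
open import Relation.Nullary.Decidable using (does)
open import Data.Bool using (if_then_else_)
open import Relation.Binary.PropositionalEquality using (_≡_; _≢_)

_≡_[mod_] : ℤ → ℤ → ℕ → Set
x ≡ y [mod n ] = (+ n) ∣ (x - y)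

-- D is square-free: the only natural m with m² ∣ D is m = 1
-- (in particular D ≠ 0).
SquareFree : ℤ → Set
SquareFree D = ∀ (m : ℕ) → ((+ m) * (+ m)) ∣ D → m ≡ 1

legendre : ℤ → (p : ℕ) → .{{ℕ.NonZero p}} → ℤ
legendre a p with a % (+ p)
... | zero = + 0
... | suc r =
  if does (any? (λ x → (x ℕ.* x) ℕ.% p ℕ.≟ suc r) (upTo p))
  then + 1 else - (+ 1)

productℕ : List ℕ → ℕ
productℕ = foldr ℕ._*_ 1

legendreProduct : ℤ → (qs : List ℕ) → All Prime qs → ℤ
legendreProduct a [] All.[] = + 1
legendreProduct a (q ∷ qs) (pq All.∷ pqs) =
  legendre a q {{Data.Nat.Primality.prime⇒nonZero pq}} * legendreProduct a qs pqs

-- Jacobi symbol (a / N) = s : writing N = q₁ ⋯ qᵣ as a product of primes,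
-- (a / N) = ∏ (a / qᵢ).  (By unique factorisation, any factorisation gives
-- the same value.)
JacobiIs : ℤ → ℕ → ℤ → Set
JacobiIs a N s =
  Σ (List ℕ) λ qs → Σ (All Prime qs) λ pqs →
    (productℕ qs ≡ N) × (legendreProduct a qs pqs ≡ s)

-- Elements a + b·θ of ℤ[θ] (θ = √D if D ≡ 2,3 mod 4, θ = ω = (1+√D)/2 if
-- D ≡ 1 mod 4), represented by integer coordinates (a , b).
QElt : Set
QElt = ℤ × ℤ

mulQ : ℤ → QElt → QElt → QElt
mulQ D (a , b) (c , d) with D % (+ 4)
... | 1 = let m = (D - + 1) / (+ 4) in   -- ω² = ω + (D-1)/4
          (a * c + m * (b * d)) , (a * d + b * c + b * d)
... | _ = (a * c + D * (b * d)) , (a * d + b * c)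

oneQ : QElt
oneQ = (+ 1 , + 0)

addQ : QElt → QElt → QElt
addQ (a , b) (c , d) = (a + c , b + d)

powQ : ℤ → QElt → ℕ → QElt
powQ D x zero = oneQ
powQ D x (suc n) = mulQ D x (powQ D x n)

normQ : ℤ → QElt → ℤ
normQ D (a , b) with D % (+ 4)
... | 1 = a * a + a * b + ((+ 1 - D) / (+ 4)) * (b * b)
... | _ = a * a - D * (b * b)

_≡Q_[mod_] : QElt → QElt → ℕ → Set
(a , b) ≡Q (c , d) [mod n ] = (a ≡ c [mod n ]) × (b ≡ d [mod n ])

InG : ℕ → ℤ → QElt → Set
InG n D w = normQ D w ≡ + 1 [mod n ]

cyclotomicQ : ℤ → ℕ → QElt → QElt
cyclotomicQ D p x = foldr (λ i acc → addQ (powQ D x i) acc) (+ 0 , + 0) (upTo p)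

module Submission where

-- Let q be a prime divisor of N. As N is odd and p ∣ N + 1, q is odd and q ≠ p. Modulo q,
-- w is a norm-one element of ℤ[θ]/(q), on which the Frobenius x ↦ x^q fixes the integers and
-- sends δ = 2θ - t (with δ² = Δ the discriminant) to δ Δ^((q-1)/2), which is δ, -δ or 0 by
-- Euler's criterion. Hence w^(q-1), w^(q+1) or w^(q(q-1)) is 1. By (i), u = w^(c k p^(j-1)) is
-- a root of Φ_p, so u^p = 1, and u ≠ 1 because Φ_p(1) = p ≢ 0 mod q. Therefore p^j divides
-- that exponent, and since p is odd and prime to q, p^j ≤ q. So every prime divisor of N is
-- at least p^j, while N < c k p^ℓ ≤ p^(2j) by (ii): N is prime.

open import Algebra.Bundles using (Semiring; CommutativeRing)
open import Data.Nat as ℕ using (ℕ)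
open import Data.Nat.Primality using (Prime)
open import Data.Integer using (ℤ)

module Arithmetic where
  open import Data.Nat
  open import Data.Nat.Properties
  open import Data.Nat.Divisibility
  open import Data.Nat.DivMod using (m*n/n≡m; m≡m%n+[m/n]*n; m%n<n)
  open import Data.Nat.Combinatorics using (_C_; nCk≡n!/k![n-k]!; k![n∸k]!∣n!)
  open import Data.Nat.Coprimality using (Coprime; coprime-divisor)
  open import Data.Nat.Primality
    using (prime⇒irreducible; prime⇒nonTrivial; prime⇒nonZero; euclidsLemma; prime[2]; ¬prime[1];
           _Rough_; 0-rough; 1-rough; 2-rough; ∤⇒rough-suc; rough∧∣⇒prime)
  open import Data.Nat.Tactic.RingSolver using (solve)
  open import Data.List using ([]; _∷_)
  open import Data.Product using (_,_)
  open import Data.Sum using (_⊎_; inj₁; inj₂; [_,_]′)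
  open import Function using (_∘_)
  open import Relation.Nullary using (contradiction)
  open import Relation.Binary.PropositionalEquality

  prime>1 : ∀ {p} → Prime p → 1 < p
  prime>1 {p} p-prime = nonTrivial⇒n>1 p {{prime⇒nonTrivial p-prime}}

  prime∤⇒coprime : ∀ {p n} → Prime p → p ∤ n → Coprime p n
  prime∤⇒coprime p-prime p∤n (d∣p , d∣n) with prime⇒irreducible p-prime d∣p
  ... | inj₁ d≡1  = d≡1
  ... | inj₂ refl = contradiction d∣n p∤n

  prime∣^⇒∣ : ∀ {q p} → Prime q → ∀ k → q ∣ p ^ k → q ∣ p
  prime∣^⇒∣ q-prime zero    q∣1 = contradiction (∣⇒≤ q∣1) (<⇒≱ (prime>1 q-prime))
  prime∣^⇒∣ {p = p} q-prime (suc k) q∣pᵏ⁺¹ with euclidsLemma p (p ^ k) q-prime q∣pᵏ⁺¹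
  ... | inj₁ q∣p  = q∣p
  ... | inj₂ q∣pᵏ = prime∣^⇒∣ q-prime k q∣pᵏ

  prime-power-coprime : ∀ {p q} → Prime p → Prime q → p ≢ q → ∀ k → Coprime (p ^ k) q
  prime-power-coprime p-prime q-prime p≢q k (d∣pᵏ , d∣q) with prime⇒irreducible q-prime d∣q
  ... | inj₁ d≡1  = d≡1
  ... | inj₂ refl with prime⇒irreducible p-prime (prime∣^⇒∣ q-prime k d∣pᵏ)
  ...   | inj₁ q≡1 = contradiction q≡1 (>⇒≢ (prime>1 q-prime))
  ...   | inj₂ q≡p = contradiction (sym q≡p) p≢q

  prime∤! : ∀ {p} → Prime p → ∀ m → m < p → p ∤ m !
  prime∤! p-prime zero    m<p p∣1  = <⇒≱ (prime>1 p-prime) (∣⇒≤ p∣1)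
  prime∤! p-prime (suc m) m<p p∣m! with euclidsLemma (suc m) (m !) p-prime p∣m!
  ... | inj₁ p∣1+m = <⇒≱ m<p (∣⇒≤ p∣1+m)
  ... | inj₂ p∣m!  = prime∤! p-prime m (<-trans (n<1+n m) m<p) p∣m!

  prime∣pCk : ∀ {p k} → Prime p → 0 < k → k < p → p ∣ p C k
  prime∣pCk {p} {k} p-prime 0<k k<p with k![n∸k]!∣n! (<⇒≤ k<p)
  ... | divides Q p!≡Qk![p∸k]! = subst (p ∣_) (sym pCk≡Q) p∣Q
    where
    instance _ = k !* (p ∸ k) !≢0
    pCk≡Q : p C k ≡ Q
    pCk≡Q = trans (nCk≡n!/k![n-k]! (<⇒≤ k<p))
              (trans (cong (_/ (k ! * (p ∸ k) !)) p!≡Qk![p∸k]!) (m*n/n≡m Q _))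
    p∣p! : p ∣ p !
    p∣p! = subst (λ n → n ∣ n !) (suc-pred p {{prime⇒nonZero p-prime}}) (m∣m*n {suc (pred p)} (pred p !))
    p∣Q : p ∣ Q
    p∣Q with euclidsLemma Q (k ! * (p ∸ k) !) p-prime (subst (p ∣_) p!≡Qk![p∸k]! p∣p!)
    ... | inj₁ p∣Q = p∣Q
    ... | inj₂ p∣k![p∸k]! with euclidsLemma (k !) ((p ∸ k) !) p-prime p∣k![p∸k]!
    ...   | inj₁ p∣k!      = contradiction p∣k! (prime∤! p-prime k k<p)
    ...   | inj₂ p∣[p∸k]!  = contradiction p∣[p∸k]! (prime∤! p-prime (p ∸ k) (∸-monoʳ-< 0<k (<⇒≤ k<p)))

  ^-monoʳ-∣ : ∀ p {i j} → i ≤ j → p ^ i ∣ p ^ j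
  ^-monoʳ-∣ p {i} {j} i≤j = divides (p ^ (j ∸ i)) (begin
    p ^ j                ≡⟨ cong (p ^_) (m∸n+n≡m i≤j) ⟨
    p ^ (j ∸ i + i)      ≡⟨ ^-distribˡ-+-* p (j ∸ i) i ⟩
    p ^ (j ∸ i) * p ^ i  ∎)
    where open ≡-Reasoning

  m^[2*n]≡m^n*m^n : ∀ m n → m ^ (2 * n) ≡ m ^ n * m ^ n
  m^[2*n]≡m^n*m^n m n = trans (^-distribˡ-+-* m n (n + 0)) (cong (λ k → m ^ n * m ^ k) (+-identityʳ n))

  odd⇒≢2 : ∀ {p} → p % 2 ≡ 1 → p ≢ 2
  odd⇒≢2 p%2≡1 refl = 0≢1+n p%2≡1

  odd⇒≡1+[n/2+n/2] : ∀ {n} → n % 2 ≡ 1 → n ≡ suc (n / 2 + n / 2)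
  odd⇒≡1+[n/2+n/2] {n} n%2≡1 = trans (m≡m%n+[m/n]*n n 2) (cong₂ _+_ n%2≡1 (x*2≡x+x (n / 2)))
    where
    x*2≡x+x : ∀ x → x * 2 ≡ x + x
    x*2≡x+x x = solve (x ∷ [])

  ∣odd⇒odd : ∀ {q n} → q ∣ n → n % 2 ≡ 1 → q % 2 ≡ 1
  ∣odd⇒odd {q} {n} q∣n n%2≡1 with q % 2 in q%2≡ | m%n<n q 2
  ... | 0           | _ =
    contradiction (trans (sym (n∣m⇒m%n≡0 n 2 (∣-trans (m%n≡0⇒n∣m q 2 q%2≡) q∣n))) n%2≡1) 0≢1+n
  ... | 1           | _ = refl
  ... | suc (suc _) | s≤s (s≤s ())

  p^k∣q-1∨q+1∨q[q-1]⇒p^k≤q : ∀ {p r k} → Prime p → Prime (suc (r + r)) → p ≢ 2 → p ≢ suc (r + r) →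
    p ^ k ∣ r + r ⊎ p ^ k ∣ suc (suc (r + r)) ⊎ p ^ k ∣ suc (r + r) * (r + r) →
    p ^ k ≤ suc (r + r)
  p^k∣q-1∨q+1∨q[q-1]⇒p^k≤q {p} {r} {k} p-prime q-prime p≢2 p≢q = [ ∣q-1 , [ ∣q+1 , ∣q[q-1] ]′ ]′
    where
    r≢0 : r ≢ 0
    r≢0 refl = ¬prime[1] q-prime
    ∣q-1 : p ^ k ∣ r + r → p ^ k ≤ suc (r + r)
    ∣q-1 pᵏ∣q-1 = m≤n⇒m≤1+n (∣⇒≤ {{≢-nonZero (r≢0 ∘ m+n≡0⇒m≡0 r)}} pᵏ∣q-1)
    q+1≡2[1+r] : suc (suc (r + r)) ≡ 2 * suc r
    q+1≡2[1+r] = solve (r ∷ [])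
    ∣q+1 : p ^ k ∣ suc (suc (r + r)) → p ^ k ≤ suc (r + r)
    ∣q+1 pᵏ∣q+1 = ≤-trans
      (∣⇒≤ (coprime-divisor (prime-power-coprime p-prime prime[2] p≢2 k) (subst (p ^ k ∣_) q+1≡2[1+r] pᵏ∣q+1)))
      (s≤s (m≤m+n r r))
    ∣q[q-1] : p ^ k ∣ suc (r + r) * (r + r) → p ^ k ≤ suc (r + r)
    ∣q[q-1] = ∣q-1 ∘ coprime-divisor (prime-power-coprime p-prime q-prime p≢q k)

  primes≥⇒rough : ∀ {n} m → (∀ {q} → Prime q → q ∣ n → m ≤ q) → m Rough n
  primes≥⇒rough zero                _ = 0-rough
  primes≥⇒rough (suc zero)          _ = 1-rough
  primes≥⇒rough (suc (suc zero))    _ = 2-rough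
  primes≥⇒rough (suc (suc (suc k))) primes≥3+k =
    let 2+k-rough = primes≥⇒rough (suc (suc k)) (λ q-prime q∣n → <⇒≤ (primes≥3+k q-prime q∣n))
    in ∤⇒rough-suc (λ 2+k∣n → <-irrefl refl (primes≥3+k (rough∧∣⇒prime 2+k-rough 2+k∣n) 2+k∣n)) 2+k-rough

module SemiringPowers {c ℓ} (S : Semiring c ℓ) where
  open import Data.Nat using (zero; suc; _≤_; s≤s)
  import Data.Nat.Properties as ℕₚ
  open import Data.Nat.Divisibility using (_∣_; divides; _∣?_; 1∣_; n∣m*n; *-monoˡ-∣; *-monoʳ-∣)
  open import Data.Nat.Coprimality using (Coprime; coprime-Bézout)
  open import Data.Nat.GCD using (module Bézout)
  open import Relation.Nullary using (yes; no; contradiction)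
  open import Relation.Binary.PropositionalEquality as ≡ using (_≡_; cong)
  open Arithmetic using (prime∤⇒coprime; ^-monoʳ-∣)
  open Semiring S
  open import Algebra.Properties.Semiring.Exp S
  open import Relation.Binary.Reasoning.Setoid setoid

  1#^n≈1# : ∀ n → 1# ^ n ≈ 1#
  1#^n≈1# zero    = refl
  1#^n≈1# (suc n) = trans (*-identityˡ (1# ^ n)) (1#^n≈1# n)

  ^≈1#⇒^*≈1# : ∀ {x} m n → x ^ m ≈ 1# → x ^ (m ℕ.* n) ≈ 1#
  ^≈1#⇒^*≈1# {x} m n xᵐ≈1 = begin
    x ^ (m ℕ.* n)  ≈⟨ ^-assocʳ x m n ⟨
    (x ^ m) ^ n    ≈⟨ ^-congˡ n xᵐ≈1 ⟩
    1# ^ n         ≈⟨ 1#^n≈1# n ⟩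
    1#             ∎

  ∣⇒^≈1# : ∀ {x m n} → x ^ m ≈ 1# → m ∣ n → x ^ n ≈ 1#
  ∣⇒^≈1# {x} {m} xᵐ≈1 (divides k ≡.refl) =
    trans (^-congʳ x (ℕₚ.*-comm k m)) (^≈1#⇒^*≈1# m k xᵐ≈1)

  private
    Bézout⇒≈1# : ∀ {x} m n a b → 1 ℕ.+ b ℕ.* n ≡ a ℕ.* m → x ^ m ≈ 1# → x ^ n ≈ 1# → x ≈ 1#
    Bézout⇒≈1# {x} m n a b 1+bn≡am xᵐ≈1 xⁿ≈1 = begin
      x                  ≈⟨ *-identityʳ x ⟨
      x * 1#             ≈⟨ *-congˡ (∣⇒^≈1# xⁿ≈1 (n∣m*n b)) ⟨
      x ^ suc (b ℕ.* n)  ≡⟨ cong (x ^_) 1+bn≡am ⟩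
      x ^ (a ℕ.* m)      ≈⟨ ∣⇒^≈1# xᵐ≈1 (n∣m*n a) ⟩
      1#                 ∎

  coprime-exponents⇒≈1# : ∀ {x m n} → Coprime m n → x ^ m ≈ 1# → x ^ n ≈ 1# → x ≈ 1#
  coprime-exponents⇒≈1# {m = m} {n} coprime xᵐ≈1 xⁿ≈1 with coprime-Bézout coprime
  ... | Bézout.+- a b 1+bn≡am = Bézout⇒≈1# m n a b 1+bn≡am xᵐ≈1 xⁿ≈1
  ... | Bézout.-+ a b 1+am≡bn = Bézout⇒≈1# n m b a 1+am≡bn xⁿ≈1 xᵐ≈1

  prime-order⇒∣ : ∀ {x p n} → Prime p → x ^ p ≈ 1# → x ≉ 1# → x ^ n ≈ 1# → p ∣ n
  prime-order⇒∣ {p = p} {n} p-prime xᵖ≈1 x≉1 xⁿ≈1 with p ∣? n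
  ... | yes p∣n = p∣n
  ... | no  p∤n = contradiction (coprime-exponents⇒≈1# (prime∤⇒coprime p-prime p∤n) xᵖ≈1 xⁿ≈1) x≉1

  prime-power-order⇒∣ : ∀ {y p j E} → Prime p →
    y ^ (p ℕ.^ suc j) ≈ 1# → y ^ (p ℕ.^ j) ≉ 1# → y ^ E ≈ 1# → p ℕ.^ suc j ∣ E
  prime-power-order⇒∣ {y} {p} {j} {E} p-prime y^pʲ⁺¹≈1 y^pʲ≉1 yᴱ≈1 = pⁱ∣E (suc j) ℕₚ.≤-refl
    where
    uᵖ≈1 : (y ^ (p ℕ.^ j)) ^ p ≈ 1#
    uᵖ≈1 = trans (^-assocʳ y (p ℕ.^ j) p) (trans (^-congʳ y (ℕₚ.*-comm (p ℕ.^ j) p)) y^pʲ⁺¹≈1)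
    pⁱ∣E : ∀ i → i ≤ suc j → p ℕ.^ i ∣ E
    pⁱ∣E zero    _         = 1∣ E
    pⁱ∣E (suc i) (s≤s i≤j) with pⁱ∣E i (ℕₚ.m≤n⇒m≤1+n i≤j)
    ... | divides E′ E≡E′pⁱ = ≡.subst (p ℕ.^ suc i ∣_) (≡.sym E≡E′pⁱ) (*-monoˡ-∣ (p ℕ.^ i) p∣E′)
      where
      E∣pʲE′ : E ∣ p ℕ.^ j ℕ.* E′
      E∣pʲE′ = ≡.subst₂ _∣_ (≡.sym E≡E′pⁱ) (ℕₚ.*-comm E′ (p ℕ.^ j))
                 (*-monoʳ-∣ E′ (^-monoʳ-∣ p i≤j))
      p∣E′ : p ∣ E′
      p∣E′ = prime-order⇒∣ p-prime uᵖ≈1 y^pʲ≉1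
               (trans (^-assocʳ y (p ℕ.^ j) E′) (∣⇒^≈1# yᴱ≈1 E∣pʲE′))

module PowerSums {c ℓ} (S : Semiring c ℓ) where
  open import Data.Nat using (suc)
  import Data.Nat.Properties as ℕₚ
  open import Data.Nat.Divisibility using (_∣_)
  open import Data.List using (List; []; _∷_; _++_; [_]; foldr; map; length; upTo)
  open import Data.List.Properties using (upTo-∷ʳ; map-applyUpTo; length-upTo)
  open import Function using (_∘_)
  open import Relation.Binary.PropositionalEquality as ≡ using ()
  open Semiring S
  open import Algebra.Properties.Semiring.Exp S
  open import Algebra.Properties.Semiring.Mult S using (_×_; ×-congˡ)
  open SemiringPowers S using (1#^n≈1#; ^≈1#⇒^*≈1#; prime-power-order⇒∣)
  open import Relation.Binary.Reasoning.Setoid setoid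

  powerSum : Carrier → List ℕ → Carrier
  powerSum x = foldr (λ i s → x ^ i + s) 0#

  powerSum-++ : ∀ x is js → powerSum x (is ++ js) ≈ powerSum x is + powerSum x js
  powerSum-++ x []       js = sym (+-identityˡ (powerSum x js))
  powerSum-++ x (i ∷ is) js = trans (+-congˡ (powerSum-++ x is js)) (sym (+-assoc (x ^ i) _ _))

  *-powerSum : ∀ x is → x * powerSum x is ≈ powerSum x (map suc is)
  *-powerSum x []       = zeroʳ x
  *-powerSum x (i ∷ is) = trans (distribˡ x (x ^ i) (powerSum x is)) (+-congˡ (*-powerSum x is))

  geometric-sum : ∀ x n → 1# + x * powerSum x (upTo n) ≈ powerSum x (upTo n) + x ^ n
  geometric-sum x n = begin
    1# + x * powerSum x (upTo n)          ≈⟨ +-congˡ (*-powerSum x (upTo n)) ⟩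
    1# + powerSum x (map suc (upTo n))    ≡⟨ ≡.cong (λ is → 1# + powerSum x is) (map-applyUpTo _ suc n) ⟩
    powerSum x (upTo (suc n))             ≡⟨ ≡.cong (powerSum x) (upTo-∷ʳ n) ⟨
    powerSum x (upTo n ++ [ n ])          ≈⟨ powerSum-++ x (upTo n) [ n ] ⟩
    powerSum x (upTo n) + (x ^ n + 0#)    ≈⟨ +-congˡ (+-identityʳ (x ^ n)) ⟩
    powerSum x (upTo n) + x ^ n           ∎

  powerSum≈0#⇒^≈1# : ∀ x n → powerSum x (upTo n) ≈ 0# → x ^ n ≈ 1#
  powerSum≈0#⇒^≈1# x n Φ≈0 = begin
    x ^ n                         ≈⟨ +-identityˡ (x ^ n) ⟨
    0# + x ^ n                    ≈⟨ +-congʳ Φ≈0 ⟨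
    powerSum x (upTo n) + x ^ n   ≈⟨ geometric-sum x n ⟨
    1# + x * powerSum x (upTo n)  ≈⟨ +-congˡ (trans (*-congˡ Φ≈0) (zeroʳ x)) ⟩
    1# + 0#                       ≈⟨ +-identityʳ 1# ⟩
    1#                            ∎

  powerSum-≈1# : ∀ {x} is → x ≈ 1# → powerSum x is ≈ length is × 1#
  powerSum-≈1# []       x≈1 = refl
  powerSum-≈1# (i ∷ is) x≈1 = +-cong (trans (^-congˡ i x≈1) (1#^n≈1# i)) (powerSum-≈1# is x≈1)

  powerSum-upTo-≈1# : ∀ {x} n → x ≈ 1# → powerSum x (upTo n) ≈ n × 1#
  powerSum-upTo-≈1# n x≈1 = trans (powerSum-≈1# (upTo n) x≈1) (×-congˡ (length-upTo n))

  cyclotomic-root⇒prime-power∣exponent : ∀ {x h p j E} → Prime p → p × 1# ≉ 0# →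
    powerSum (x ^ (h ℕ.* p ℕ.^ j)) (upTo p) ≈ 0# → x ^ E ≈ 1# → p ℕ.^ suc j ∣ E
  cyclotomic-root⇒prime-power∣exponent {x} {h} {p} {j} {E} p-prime p≉0 Φ≈0 xᴱ≈1 =
    prime-power-order⇒∣ {y = y} {j = j} p-prime y^pʲ⁺¹≈1 (u≉1 ∘ trans (sym yᵖʲ≈u)) yᴱ≈1
    where
    y u : Carrier
    y = x ^ h
    u = x ^ (h ℕ.* p ℕ.^ j)
    yᵖʲ≈u : y ^ (p ℕ.^ j) ≈ u
    yᵖʲ≈u = ^-assocʳ x h (p ℕ.^ j)
    u≉1 : u ≉ 1#
    u≉1 u≈1 = p≉0 (trans (sym (powerSum-upTo-≈1# p u≈1)) Φ≈0)
    y^pʲ⁺¹≈1 : y ^ (p ℕ.^ suc j) ≈ 1#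
    y^pʲ⁺¹≈1 = begin
      y ^ (p ℕ.* p ℕ.^ j)    ≡⟨ ≡.cong (y ^_) (ℕₚ.*-comm p (p ℕ.^ j)) ⟩
      y ^ (p ℕ.^ j ℕ.* p)    ≈⟨ ^-assocʳ y (p ℕ.^ j) p ⟨
      (y ^ (p ℕ.^ j)) ^ p    ≈⟨ ^-congˡ p yᵖʲ≈u ⟩
      u ^ p                  ≈⟨ powerSum≈0#⇒^≈1# u p Φ≈0 ⟩
      1#                     ∎
    yᴱ≈1 : y ^ E ≈ 1#
    yᴱ≈1 = begin
      (x ^ h) ^ E    ≈⟨ ^-assocʳ x h E ⟩
      x ^ (h ℕ.* E)  ≡⟨ ≡.cong (x ^_) (ℕₚ.*-comm h E) ⟩
      x ^ (E ℕ.* h)  ≈⟨ ^≈1#⇒^*≈1# E h xᴱ≈1 ⟩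
      1#             ∎

module PrimeCharacteristic {c ℓ} (R : CommutativeRing c ℓ) where
  open import Data.Nat using (zero; suc; _<_; _∸_; z<s; s<s)
  import Data.Nat.Properties as ℕₚ
  open import Data.Nat.Combinatorics using (_C_; nCn≡1)
  open import Data.Nat.Divisibility using (_∣_; divides)
  open import Data.Nat.Primality using (prime⇒nonZero)
  open import Data.Fin as Fin using (Fin; toℕ; fromℕ)
  open import Data.Fin.Properties using (toℕ-fromℕ; inject₁ℕ<)
  open import Data.Vec.Functional using (replicate)
  open import Relation.Binary.PropositionalEquality as ≡ using (_≡_; cong; cong₂)
  open CommutativeRing R
  open import Algebra.Properties.Semiring.Exp semiring
  open import Algebra.Properties.Semiring.Mult semiring using (_×_; ×-congʳ; ×-assoc-*; ×1-homo-*)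
  open import Algebra.Properties.Semiring.Sum semiring using (sum; sum-init-last; sum-cong-≋; sum-replicate-zero)
  open import Algebra.Properties.CommutativeSemiring.Binomial commutativeSemiring using (theorem; binomialTerm)
  open import Algebra.Properties.Group +-group using (inverseʳ-unique)
  open SemiringPowers semiring using (1#^n≈1#)
  open Arithmetic using (prime∣pCk)
  open import Relation.Binary.Reasoning.Setoid setoid

  private
    binomial-ends : ∀ n x y → (∀ k → 0 < k → k < suc n → ∀ z → (suc n C k) × z ≈ 0#) →
                    (x + y) ^ suc n ≈ x ^ suc n + y ^ suc n
    binomial-ends n x y middle≈0 = begin
      (x + y) ^ suc n                               ≈⟨ theorem (suc n) x y ⟩
      term Fin.zero + sum (λ i → term (Fin.suc i))  ≈⟨ +-cong first≈ rest≈ ⟩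
      y ^ suc n + x ^ suc n                         ≈⟨ +-comm _ _ ⟩
      x ^ suc n + y ^ suc n                         ∎
      where
      term : Fin (suc (suc n)) → Carrier
      term = binomialTerm x y (suc n)
      first≈ : term Fin.zero ≈ y ^ suc n
      first≈ = trans (+-identityʳ _) (*-identityˡ _)
      last≈ : term (Fin.suc (fromℕ n)) ≈ x ^ suc n
      last≈ = begin
        term (Fin.suc (fromℕ n))
          ≡⟨ cong (λ i → (suc n C suc i) × (x ^ suc i * y ^ (n ∸ i))) (toℕ-fromℕ n) ⟩
        (suc n C suc n) × (x ^ suc n * y ^ (n ∸ n))
          ≡⟨ cong₂ (λ a b → a × (x ^ suc n * y ^ b)) (nCn≡1 (suc n)) (ℕₚ.n∸n≡0 n) ⟩
        x ^ suc n * 1# + 0#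
          ≈⟨ trans (+-identityʳ _) (*-identityʳ _) ⟩
        x ^ suc n ∎
      inner≈0 : ∀ i → term (Fin.suc (Fin.inject₁ i)) ≈ 0#
      inner≈0 i = middle≈0 (suc (toℕ (Fin.inject₁ i))) z<s (s<s (inject₁ℕ< i)) _
      rest≈ : sum (λ i → term (Fin.suc i)) ≈ x ^ suc n
      rest≈ = begin
        sum (λ i → term (Fin.suc i))
          ≈⟨ sum-init-last (λ i → term (Fin.suc i)) ⟩
        sum (λ i → term (Fin.suc (Fin.inject₁ i))) + term (Fin.suc (fromℕ n))
          ≈⟨ +-cong (sum-cong-≋ inner≈0) last≈ ⟩
        sum (replicate n 0#) + x ^ suc n
          ≈⟨ +-congʳ (sum-replicate-zero n) ⟩
        0# + x ^ suc n
          ≈⟨ +-identityˡ _ ⟩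
        x ^ suc n ∎

  module Characteristic {q} (q-prime : Prime q) (q×1#≈0# : q × 1# ≈ 0#) where

    private
      q′ : ℕ
      q′ = ℕ.pred q
      q≡1+q′ : q ≡ suc q′
      q≡1+q′ = ≡.sym (ℕₚ.suc-pred q {{prime⇒nonZero q-prime}})

    ∣⇒×≈0# : ∀ {k} → q ∣ k → ∀ x → k × x ≈ 0#
    ∣⇒×≈0# (divides l ≡.refl) x = begin
      (l ℕ.* q) × x              ≈⟨ ×-congʳ (l ℕ.* q) (*-identityˡ x) ⟨
      (l ℕ.* q) × (1# * x)       ≈⟨ ×-assoc-* (l ℕ.* q) 1# x ⟨
      ((l ℕ.* q) × 1#) * x       ≈⟨ *-congʳ (×1-homo-* l q) ⟩
      ((l × 1#) * (q × 1#)) * x  ≈⟨ *-congʳ (*-congˡ q×1#≈0#) ⟩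
      ((l × 1#) * 0#) * x        ≈⟨ *-congʳ (zeroʳ (l × 1#)) ⟩
      0# * x                     ≈⟨ zeroˡ x ⟩
      0#                         ∎

    freshman's-dream : ∀ x y → (x + y) ^ q ≈ x ^ q + y ^ q
    freshman's-dream x y = begin
      (x + y) ^ q              ≡⟨ cong ((x + y) ^_) q≡1+q′ ⟩
      (x + y) ^ suc q′         ≈⟨ binomial-ends q′ x y middle≈0 ⟩
      x ^ suc q′ + y ^ suc q′  ≡⟨ cong (λ n → x ^ n + y ^ n) q≡1+q′ ⟨
      x ^ q + y ^ q            ∎
      where
      middle≈0 : ∀ k → 0 < k → k < suc q′ → ∀ z → (suc q′ C k) × z ≈ 0#
      middle≈0 k 0<k k<1+q′ = ∣⇒×≈0# (≡.subst (λ n → q ∣ n C k) q≡1+q′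
        (prime∣pCk q-prime 0<k (≡.subst (k <_) (≡.sym q≡1+q′) k<1+q′)))

    0#^q≈0# : 0# ^ q ≈ 0#
    0#^q≈0# = trans (^-congʳ 0# q≡1+q′) (zeroˡ (0# ^ q′))

    -‿^q : ∀ x → (- x) ^ q ≈ - (x ^ q)
    -‿^q x = inverseʳ-unique (x ^ q) ((- x) ^ q) (begin
      x ^ q + (- x) ^ q  ≈⟨ freshman's-dream x (- x) ⟨
      (x - x) ^ q        ≈⟨ ^-congˡ q (-‿inverseʳ x) ⟩
      0# ^ q             ≈⟨ 0#^q≈0# ⟩
      0#                 ∎)

    fermat : ∀ n → (n × 1#) ^ q ≈ n × 1#
    fermat zero    = 0#^q≈0#
    fermat (suc n) = begin
      (1# + n × 1#) ^ q      ≈⟨ freshman's-dream 1# (n × 1#) ⟩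
      1# ^ q + (n × 1#) ^ q  ≈⟨ +-cong (1#^n≈1# q) (fermat n) ⟩
      1# + n × 1#            ∎

module NormOneFrobenius {c ℓ} (R : CommutativeRing c ℓ) where
  open import Data.Nat using (suc)
  open import Data.Sum using (_⊎_)
  import Data.Sum as Sum
  open CommutativeRing R
  open import Algebra.Properties.Semiring.Exp semiring
  open import Algebra.Properties.CommutativeSemiring.Exp commutativeSemiring using (^-distrib-*)
  open import Algebra.Properties.Semiring.Mult semiring using (_×_)
  open import Algebra.Properties.Ring ring using (-‿distribʳ-*)
  open SemiringPowers semiring using (1#^n≈1#)
  open PrimeCharacteristic R using (module Characteristic)
  open import Relation.Binary.Reasoning.Setoid setoid

  invertible∧^suc≈⇒^≈1# : ∀ {x y} n → x * y ≈ 1# → x ^ suc n ≈ x → x ^ n ≈ 1#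
  invertible∧^suc≈⇒^≈1# {x} {y} n xy≈1 xⁿ⁺¹≈x = begin
    x ^ n            ≈⟨ *-identityʳ (x ^ n) ⟨
    x ^ n * 1#       ≈⟨ *-congˡ xy≈1 ⟨
    x ^ n * (x * y)  ≈⟨ *-assoc (x ^ n) x y ⟨
    (x ^ n * x) * y  ≈⟨ *-congʳ (*-comm (x ^ n) x) ⟩
    x ^ suc n * y    ≈⟨ *-congʳ xⁿ⁺¹≈x ⟩
    x * y            ≈⟨ xy≈1 ⟩
    1#               ∎

  frobenius-square-root : ∀ r {δ Δ} → δ * δ ≈ Δ → δ ^ suc (r ℕ.+ r) ≈ δ * Δ ^ r
  frobenius-square-root r {δ} {Δ} δ²≈Δ = begin
    δ * δ ^ (r ℕ.+ r)    ≈⟨ *-congˡ (^-homo-* δ r r) ⟩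
    δ * (δ ^ r * δ ^ r)  ≈⟨ *-congˡ (^-distrib-* δ δ r) ⟨
    δ * (δ * δ) ^ r      ≈⟨ *-congˡ (^-congˡ r δ²≈Δ) ⟩
    δ * Δ ^ r            ∎

  frobenius-square-root-cases : ∀ r {δ Δ} → δ * δ ≈ Δ → Δ ^ r ≈ 1# ⊎ Δ ^ r ≈ - 1# ⊎ Δ ^ r ≈ 0# →
    δ ^ suc (r ℕ.+ r) ≈ δ ⊎ δ ^ suc (r ℕ.+ r) ≈ - δ ⊎ δ ^ suc (r ℕ.+ r) ≈ 0#
  frobenius-square-root-cases r {δ} {Δ} δ²≈Δ = Sum.map Δʳ≈1⇒ (Sum.map Δʳ≈-1⇒ Δʳ≈0⇒)
    where
    δᵠ≈δΔʳ : δ ^ suc (r ℕ.+ r) ≈ δ * Δ ^ r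
    δᵠ≈δΔʳ = frobenius-square-root r δ²≈Δ
    Δʳ≈1⇒ : Δ ^ r ≈ 1# → δ ^ suc (r ℕ.+ r) ≈ δ
    Δʳ≈1⇒ Δʳ≈1 = trans δᵠ≈δΔʳ (trans (*-congˡ Δʳ≈1) (*-identityʳ δ))
    Δʳ≈-1⇒ : Δ ^ r ≈ - 1# → δ ^ suc (r ℕ.+ r) ≈ - δ
    Δʳ≈-1⇒ Δʳ≈-1 = begin
      δ ^ suc (r ℕ.+ r)  ≈⟨ δᵠ≈δΔʳ ⟩
      δ * Δ ^ r          ≈⟨ *-congˡ Δʳ≈-1 ⟩
      δ * - 1#           ≈⟨ -‿distribʳ-* δ 1# ⟨
      - (δ * 1#)         ≈⟨ -‿cong (*-identityʳ δ) ⟩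
      - δ                ∎
    Δʳ≈0⇒ : Δ ^ r ≈ 0# → δ ^ suc (r ℕ.+ r) ≈ 0#
    Δʳ≈0⇒ Δʳ≈0 = trans δᵠ≈δΔʳ (trans (*-congˡ Δʳ≈0) (zeroʳ δ))

  module _ {r : ℕ} (q-prime : Prime (suc (r ℕ.+ r))) (q×1#≈0# : suc (r ℕ.+ r) × 1# ≈ 0#) where
    open Characteristic q-prime q×1#≈0#

    private
      q : ℕ
      q = suc (r ℕ.+ r)

    -- Used with s = 2 and δ = 2θ - t, for which 2 (a + b θ) = (2a + t b) + b δ.
    norm-one-order : ∀ {s α β δ w w̄} → (∀ {x y} → s * x ≈ s * y → x ≈ y) →
      s ^ q ≈ s → α ^ q ≈ α → β ^ q ≈ β →
      s * w ≈ α + β * δ → s * w̄ ≈ α - β * δ → w * w̄ ≈ 1# →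
      δ ^ q ≈ δ ⊎ δ ^ q ≈ - δ ⊎ δ ^ q ≈ 0# →
      w ^ (r ℕ.+ r) ≈ 1# ⊎ w ^ suc q ≈ 1# ⊎ w ^ (q ℕ.* (r ℕ.+ r)) ≈ 1#
    norm-one-order {s} {α} {β} {δ} {w} {w̄} s-cancel sᵠ≈s αᵠ≈α βᵠ≈β sw≈α+βδ sw̄≈α-βδ ww̄≈1 =
      Sum.map δᵠ≈δ⇒ (Sum.map δᵠ≈-δ⇒ δᵠ≈0⇒)
      where
      swᵠ≈α+βδᵠ : s * w ^ q ≈ α + β * δ ^ q
      swᵠ≈α+βδᵠ = begin
        s * w ^ q            ≈⟨ *-congʳ sᵠ≈s ⟨
        s ^ q * w ^ q        ≈⟨ ^-distrib-* s w q ⟨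
        (s * w) ^ q          ≈⟨ ^-congˡ q sw≈α+βδ ⟩
        (α + β * δ) ^ q      ≈⟨ freshman's-dream α (β * δ) ⟩
        α ^ q + (β * δ) ^ q  ≈⟨ +-cong αᵠ≈α (^-distrib-* β δ q) ⟩
        α + β ^ q * δ ^ q    ≈⟨ +-congˡ (*-congʳ βᵠ≈β) ⟩
        α + β * δ ^ q        ∎

      δᵠ≈δ⇒ : δ ^ q ≈ δ → w ^ (r ℕ.+ r) ≈ 1#
      δᵠ≈δ⇒ δᵠ≈δ = invertible∧^suc≈⇒^≈1# (r ℕ.+ r) ww̄≈1 (s-cancel (begin
        s * w ^ q      ≈⟨ swᵠ≈α+βδᵠ ⟩
        α + β * δ ^ q  ≈⟨ +-congˡ (*-congˡ δᵠ≈δ) ⟩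
        α + β * δ      ≈⟨ sw≈α+βδ ⟨
        s * w          ∎))

      δᵠ≈-δ⇒ : δ ^ q ≈ - δ → w ^ suc q ≈ 1#
      δᵠ≈-δ⇒ δᵠ≈-δ = trans (*-congˡ wᵠ≈w̄) ww̄≈1
        where
        wᵠ≈w̄ : w ^ q ≈ w̄
        wᵠ≈w̄ = s-cancel (begin
          s * w ^ q      ≈⟨ swᵠ≈α+βδᵠ ⟩
          α + β * δ ^ q  ≈⟨ +-congˡ (*-congˡ δᵠ≈-δ) ⟩
          α + β * - δ    ≈⟨ +-congˡ (-‿distribʳ-* β δ) ⟨
          α - β * δ      ≈⟨ sw̄≈α-βδ ⟨
          s * w̄          ∎)

      δᵠ≈0⇒ : δ ^ q ≈ 0# → w ^ (q ℕ.* (r ℕ.+ r)) ≈ 1#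
      δᵠ≈0⇒ δᵠ≈0 = trans (sym (^-assocʳ w q (r ℕ.+ r)))
        (invertible∧^suc≈⇒^≈1# (r ℕ.+ r) wᵠw̄ᵠ≈1 (s-cancel (begin
          s * (w ^ q) ^ q      ≈⟨ *-congʳ sᵠ≈s ⟨
          s ^ q * (w ^ q) ^ q  ≈⟨ ^-distrib-* s (w ^ q) q ⟨
          (s * w ^ q) ^ q      ≈⟨ ^-congˡ q swᵠ≈α ⟩
          α ^ q                ≈⟨ αᵠ≈α ⟩
          α                    ≈⟨ swᵠ≈α ⟨
          s * w ^ q            ∎)))
        where
        swᵠ≈α : s * w ^ q ≈ α
        swᵠ≈α = begin
          s * w ^ q      ≈⟨ swᵠ≈α+βδᵠ ⟩
          α + β * δ ^ q  ≈⟨ +-congˡ (trans (*-congˡ δᵠ≈0) (zeroʳ β)) ⟩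
          α + 0#         ≈⟨ +-identityʳ α ⟩
          α              ∎
        wᵠw̄ᵠ≈1 : w ^ q * w̄ ^ q ≈ 1#
        wᵠw̄ᵠ≈1 = begin
          w ^ q * w̄ ^ q  ≈⟨ ^-distrib-* w w̄ q ⟨
          (w * w̄) ^ q    ≈⟨ ^-congˡ q ww̄≈1 ⟩
          1# ^ q         ≈⟨ 1#^n≈1# q ⟩
          1#             ∎

module IntegerCongruence (n : ℕ) where
  open import Data.Integer using (ℤ; +_; _+_; _-_; _*_; -_; ∣_∣)
  open import Data.Integer.Properties using (abs-*)
  open import Data.Integer.Divisibility.Signed
    using (_∣_; divides; ∣m∣n⇒∣m+n; ∣m⇒∣-m; ∣n⇒∣m*n; ∣ᵤ⇒∣; ∣⇒∣ᵤ)
  open import Data.Integer.Tactic.RingSolver using (solve)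
  open import Data.Nat.Divisibility using () renaming (_∣_ to _ℕ∣_; ∣-trans to ℕ∣-trans)
  open import Data.Nat.Primality using (euclidsLemma)
  open import Defs using (_≡_[mod_])
  open import Data.List using ([]; _∷_)
  open import Data.Sum using (_⊎_; inj₁; inj₂)
  import Data.Sum as Sum
  open import Relation.Nullary using (¬_; contradiction)
  open import Relation.Binary.PropositionalEquality using (_≡_; refl; subst)

  -- A record rather than a definition, so that x and y can be inferred from a proof of x ≋ y.
  infix 4 _≋_
  record _≋_ (x y : ℤ) : Set where
    constructor mod-congruent
    field n∣x-y : + n ∣ x - y

  private
    _∣-by_ : ∀ {i j} → + n ∣ i → i ≡ j → + n ∣ j
    n∣i ∣-by i≡j = subst (+ n ∣_) i≡j n∣i

  ≋-refl : ∀ {x} → x ≋ x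
  ≋-refl {x} = mod-congruent (divides (+ 0) refl ∣-by solve (x ∷ []))

  ≋-reflexive : ∀ {x y} → x ≡ y → x ≋ y
  ≋-reflexive refl = ≋-refl

  ≋-sym : ∀ {x y} → x ≋ y → y ≋ x
  ≋-sym {x} {y} (mod-congruent d) = mod-congruent (∣m⇒∣-m d ∣-by solve (x ∷ y ∷ []))

  ≋-trans : ∀ {x y z} → x ≋ y → y ≋ z → x ≋ z
  ≋-trans {x} {y} {z} (mod-congruent d) (mod-congruent e) =
    mod-congruent (∣m∣n⇒∣m+n d e ∣-by solve (x ∷ y ∷ z ∷ []))

  +-≋-cong : ∀ {x y u v} → x ≋ y → u ≋ v → x + u ≋ y + v
  +-≋-cong {x} {y} {u} {v} (mod-congruent d) (mod-congruent e) =
    mod-congruent (∣m∣n⇒∣m+n d e ∣-by solve (x ∷ y ∷ u ∷ v ∷ []))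

  *-≋-cong : ∀ {x y u v} → x ≋ y → u ≋ v → x * u ≋ y * v
  *-≋-cong {x} {y} {u} {v} (mod-congruent d) (mod-congruent e) =
    mod-congruent (∣m∣n⇒∣m+n (∣n⇒∣m*n u d) (∣n⇒∣m*n y e) ∣-by solve (x ∷ y ∷ u ∷ v ∷ []))

  -‿≋-cong : ∀ {x y} → x ≋ y → - x ≋ - y
  -‿≋-cong {x} {y} (mod-congruent d) = mod-congruent (∣m⇒∣-m d ∣-by solve (x ∷ y ∷ []))

  ≋0⇒∣ : ∀ {x} → x ≋ + 0 → + n ∣ x
  ≋0⇒∣ {x} (mod-congruent n∣x-0) = n∣x-0 ∣-by solve (x ∷ [])

  ∣⇒≋0 : ∀ {x} → + n ∣ x → x ≋ + 0
  ∣⇒≋0 {x} n∣x = mod-congruent (n∣x ∣-by solve (x ∷ []))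

  ≡[mod]⇒≋ : ∀ {N x y} → n ℕ∣ N → x ≡ y [mod N ] → x ≋ y
  ≡[mod]⇒≋ n∣N N∣x-y = mod-congruent (∣ᵤ⇒∣ (ℕ∣-trans n∣N N∣x-y))

  euclidsLemmaℤ : ∀ {p} → Prime p → ∀ x y → + p ∣ x * y → (+ p ∣ x) ⊎ (+ p ∣ y)
  euclidsLemmaℤ {p} p-prime x y p∣xy =
    Sum.map ∣ᵤ⇒∣ ∣ᵤ⇒∣
      (euclidsLemma ∣ x ∣ ∣ y ∣ p-prime (subst (p ℕ∣_) (abs-* x y) (∣⇒∣ᵤ p∣xy)))

  module _ (n-prime : Prime n) where

    *-cancelˡ-≋ : ∀ {c x y} → ¬ (+ n ∣ c) → c * x ≋ c * y → x ≋ y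
    *-cancelˡ-≋ {c} {x} {y} n∤c (mod-congruent n∣cx-cy)
      with euclidsLemmaℤ n-prime c (x - y) (n∣cx-cy ∣-by solve (c ∷ x ∷ y ∷ []))
    ... | inj₁ n∣c   = contradiction n∣c n∤c
    ... | inj₂ n∣x-y = mod-congruent n∣x-y

    z²≋1⇒z≋±1 : ∀ {z} → z * z ≋ + 1 → z ≋ + 1 ⊎ z ≋ - + 1
    z²≋1⇒z≋±1 {z} (mod-congruent n∣z²-1)
      with euclidsLemmaℤ n-prime (z - + 1) (z + + 1) (n∣z²-1 ∣-by solve (z ∷ []))
    ... | inj₁ n∣z-1 = inj₁ (mod-congruent n∣z-1)
    ... | inj₂ n∣z+1 = inj₂ (mod-congruent (n∣z+1 ∣-by solve (z ∷ [])))

module QuadraticAlgebra (t m : ℤ) where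
  open import Data.Integer using (ℤ; +_; _+_; _-_; _*_; -_)
  import Data.Integer.Properties as ℤₚ
  open import Data.Integer.Tactic.RingSolver using (solve)
  open import Data.List using ([]; _∷_)
  open import Data.Product using (_,_)
  open import Relation.Binary.PropositionalEquality using (_≡_; refl; trans; cong; cong₂)
  open import Defs using (QElt; addQ; oneQ)

  -- (a , b) stands for a + b X in ℤ[X]/(X² - t X - m); conj is induced by X ↦ t - X.
  infixl 7 _·_
  _·_ : QElt → QElt → QElt
  (a , b) · (c , d) = (a * c + m * (b * d)) , (a * d + b * c + t * (b * d))

  negQ : QElt → QElt
  negQ (a , b) = (- a , - b)

  zeroQ : QElt
  zeroQ = (+ 0 , + 0)

  conj : QElt → QElt
  conj (a , b) = (a + t * b , - b)

  -- The solver only sees through projections of pairs of variables, so for nested products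
  -- the coordinates are stated explicitly.
  ·-assoc : ∀ x y z → (x · y) · z ≡ x · (y · z)
  ·-assoc (a , b) (c , d) (e , f) = cong₂ _,_ coeff₀ coeff₁
    where
    coeff₀ : (a * c + m * (b * d)) * e + m * ((a * d + b * c + t * (b * d)) * f) ≡
             a * (c * e + m * (d * f)) + m * (b * (c * f + d * e + t * (d * f)))
    coeff₀ = solve (a ∷ b ∷ c ∷ d ∷ e ∷ f ∷ t ∷ m ∷ [])
    coeff₁ : (a * c + m * (b * d)) * f + (a * d + b * c + t * (b * d)) * e
               + t * ((a * d + b * c + t * (b * d)) * f) ≡
             a * (c * f + d * e + t * (d * f)) + b * (c * e + m * (d * f))
               + t * (b * (c * f + d * e + t * (d * f)))
    coeff₁ = solve (a ∷ b ∷ c ∷ d ∷ e ∷ f ∷ t ∷ m ∷ [])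

  ·-comm : ∀ x y → x · y ≡ y · x
  ·-comm (a , b) (c , d) = cong₂ _,_ (solve (a ∷ b ∷ c ∷ d ∷ m ∷ [])) (solve (a ∷ b ∷ c ∷ d ∷ t ∷ []))

  ·-identityˡ : ∀ x → oneQ · x ≡ x
  ·-identityˡ (a , b) = cong₂ _,_ (solve (a ∷ b ∷ m ∷ [])) (solve (a ∷ b ∷ t ∷ []))

  ·-distribˡ : ∀ x y z → x · addQ y z ≡ addQ (x · y) (x · z)
  ·-distribˡ (a , b) (c , d) (e , f) = cong₂ _,_ coeff₀ coeff₁
    where
    coeff₀ : a * (c + e) + m * (b * (d + f)) ≡ (a * c + m * (b * d)) + (a * e + m * (b * f))
    coeff₀ = solve (a ∷ b ∷ c ∷ d ∷ e ∷ f ∷ m ∷ [])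
    coeff₁ : a * (d + f) + b * (c + e) + t * (b * (d + f)) ≡
             (a * d + b * c + t * (b * d)) + (a * f + b * e + t * (b * f))
    coeff₁ = solve (a ∷ b ∷ c ∷ d ∷ e ∷ f ∷ t ∷ [])

  +-assoc : ∀ x y z → addQ (addQ x y) z ≡ addQ x (addQ y z)
  +-assoc (a , b) (c , d) (e , f) = cong₂ _,_ (ℤₚ.+-assoc a c e) (ℤₚ.+-assoc b d f)

  +-comm : ∀ x y → addQ x y ≡ addQ y x
  +-comm (a , b) (c , d) = cong₂ _,_ (ℤₚ.+-comm a c) (ℤₚ.+-comm b d)

  +-identityˡ : ∀ x → addQ zeroQ x ≡ x
  +-identityˡ (a , b) = cong₂ _,_ (ℤₚ.+-identityˡ a) (ℤₚ.+-identityˡ b)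

  -‿inverseˡ : ∀ x → addQ (negQ x) x ≡ zeroQ
  -‿inverseˡ (a , b) = cong₂ _,_ (ℤₚ.+-inverseˡ a) (ℤₚ.+-inverseˡ b)

  ι : ℤ → QElt
  ι c = (c , + 0)

  δ : QElt
  δ = (- t , + 2)

  Δ : ℤ
  Δ = t * t + + 4 * m

  ι·-pair : ∀ c a b → ι c · (a , b) ≡ (c * a , c * b)
  ι·-pair c a b = cong₂ _,_ coeff₀ coeff₁
    where
    coeff₀ : c * a + m * (+ 0 * b) ≡ c * a
    coeff₀ = solve (c ∷ a ∷ b ∷ m ∷ [])
    coeff₁ : c * b + + 0 * a + t * (+ 0 * b) ≡ c * b
    coeff₁ = solve (c ∷ a ∷ b ∷ t ∷ [])

  ι·ι : ∀ c d → ι c · ι d ≡ ι (c * d)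
  ι·ι c d = trans (ι·-pair c d (+ 0)) (cong (c * d ,_) (ℤₚ.*-zeroʳ c))

  δ·δ≡ιΔ : δ · δ ≡ ι Δ
  δ·δ≡ιΔ = cong₂ _,_ coeff₀ coeff₁
    where
    coeff₀ : - t * - t + m * (+ 2 * + 2) ≡ t * t + + 4 * m
    coeff₀ = solve (t ∷ m ∷ [])
    coeff₁ : - t * + 2 + + 2 * - t + t * (+ 2 * + 2) ≡ + 0
    coeff₁ = solve (t ∷ [])

  ι2·w≡α+βδ : ∀ a b → ι (+ 2) · (a , b) ≡ addQ (ι (+ 2 * a + t * b)) (ι b · δ)
  ι2·w≡α+βδ a b = cong₂ _,_ coeff₀ coeff₁
    where
    coeff₀ : + 2 * a + m * (+ 0 * b) ≡ (+ 2 * a + t * b) + (b * - t + m * (+ 0 * + 2))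
    coeff₀ = solve (a ∷ b ∷ t ∷ m ∷ [])
    coeff₁ : + 2 * b + + 0 * a + t * (+ 0 * b) ≡ + 0 + (b * + 2 + + 0 * - t + t * (+ 0 * + 2))
    coeff₁ = solve (a ∷ b ∷ t ∷ [])

  ι2·w̄≡α-βδ : ∀ a b → ι (+ 2) · conj (a , b) ≡ addQ (ι (+ 2 * a + t * b)) (negQ (ι b · δ))
  ι2·w̄≡α-βδ a b = cong₂ _,_ coeff₀ coeff₁
    where
    coeff₀ : + 2 * (a + t * b) + m * (+ 0 * - b) ≡ (+ 2 * a + t * b) + - (b * - t + m * (+ 0 * + 2))
    coeff₀ = solve (a ∷ b ∷ t ∷ m ∷ [])
    coeff₁ : + 2 * - b + + 0 * (a + t * b) + t * (+ 0 * - b) ≡ + 0 + - (b * + 2 + + 0 * - t + t * (+ 0 * + 2))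
    coeff₁ = solve (a ∷ b ∷ t ∷ [])

  module Modulo (n : ℕ) where
    open import Data.Product using (proj₁; proj₂)
    open import Level using (0ℓ)
    open import Relation.Binary.Bundles using (Setoid)
    open import Relation.Binary.Structures using (IsEquivalence)
    open import Algebra.Definitions using (Commutative)
    open IntegerCongruence n

    infix 4 _≈_
    record _≈_ (x y : QElt) : Set where
      constructor _≋,≋_
      field
        proj₁≋ : proj₁ x ≋ proj₁ y
        proj₂≋ : proj₂ x ≋ proj₂ y
    open _≈_ public

    ≈-reflexive : ∀ {x y} → x ≡ y → x ≈ y
    ≈-reflexive refl = ≋-refl ≋,≋ ≋-refl

    ≈-isEquivalence : IsEquivalence _≈_
    ≈-isEquivalence = record
      { refl  = ≋-refl ≋,≋ ≋-refl
      ; sym   = λ (p ≋,≋ q) → ≋-sym p ≋,≋ ≋-sym q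
      ; trans = λ (p ≋,≋ q) (p′ ≋,≋ q′) → ≋-trans p p′ ≋,≋ ≋-trans q q′
      }

    ·-cong : ∀ {x y u v} → x ≈ y → u ≈ v → x · u ≈ y · v
    ·-cong (a≋a′ ≋,≋ b≋b′) (c≋c′ ≋,≋ d≋d′) =
      +-≋-cong (*-≋-cong a≋a′ c≋c′) (*-≋-cong (≋-refl {m}) (*-≋-cong b≋b′ d≋d′)) ≋,≋
      +-≋-cong (+-≋-cong (*-≋-cong a≋a′ d≋d′) (*-≋-cong b≋b′ c≋c′))
               (*-≋-cong (≋-refl {t}) (*-≋-cong b≋b′ d≋d′))

    +-cong : ∀ {x y u v} → x ≈ y → u ≈ v → addQ x u ≈ addQ y v
    +-cong (a≋a′ ≋,≋ b≋b′) (c≋c′ ≋,≋ d≋d′) = +-≋-cong a≋a′ c≋c′ ≋,≋ +-≋-cong b≋b′ d≋d′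

    -‿cong : ∀ {x y} → x ≈ y → negQ x ≈ negQ y
    -‿cong (a≋a′ ≋,≋ b≋b′) = -‿≋-cong a≋a′ ≋,≋ -‿≋-cong b≋b′

    commutativeRing : CommutativeRing 0ℓ 0ℓ
    commutativeRing = record
      { Carrier = QElt ; _≈_ = _≈_ ; _+_ = addQ ; _*_ = _·_ ; -_ = negQ ; 0# = zeroQ ; 1# = oneQ
      ; isCommutativeRing = record
        { isRing = record
          { +-isAbelianGroup = record
            { isGroup = record
              { isMonoid = record
                { isSemigroup = record
                  { isMagma = record { isEquivalence = ≈-isEquivalence ; ∙-cong = +-cong }
                  ; assoc = λ x y z → ≈-reflexive (+-assoc x y z) }
                ; identity = comm∧idˡ⇒id +-comm≈ (λ x → ≈-reflexive (+-identityˡ x)) }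
              ; inverse = comm∧invˡ⇒inv +-comm≈ (λ x → ≈-reflexive (-‿inverseˡ x))
              ; ⁻¹-cong = -‿cong }
            ; comm = +-comm≈ }
          ; *-cong = ·-cong
          ; *-assoc = λ x y z → ≈-reflexive (·-assoc x y z)
          ; *-identity = comm∧idˡ⇒id ·-comm≈ (λ x → ≈-reflexive (·-identityˡ x))
          ; distrib = comm∧distrˡ⇒distr +-cong ·-comm≈ (λ x y z → ≈-reflexive (·-distribˡ x y z)) }
        ; *-comm = ·-comm≈ } }
      where
      setoid : Setoid 0ℓ 0ℓ
      setoid = record { isEquivalence = ≈-isEquivalence }
      open import Algebra.Consequences.Setoid setoid using (comm∧idˡ⇒id; comm∧invˡ⇒inv; comm∧distrˡ⇒distr)
      +-comm≈ : Commutative _≈_ addQ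
      +-comm≈ x y = ≈-reflexive (+-comm x y)
      ·-comm≈ : Commutative _≈_ _·_
      ·-comm≈ x y = ≈-reflexive (·-comm x y)

module QuadraticAlgebraModPrime (t m : ℤ) (r : ℕ) (q-prime : Prime (ℕ.suc (r ℕ.+ r))) where
  open import Data.Nat using (suc; s≤s; ≢-nonZero)
  import Data.Nat.Properties as ℕₚ
  open import Data.Nat.Divisibility using (∣⇒≤) renaming (_∣_ to _ℕ∣_)
  open import Data.Nat.Primality using (¬prime[1]; prime⇒irreducible)
  open import Data.Integer as ℤ using (+_; -[1+_])
  import Data.Integer.Properties as ℤₚ
  open import Data.Integer.Divisibility.Signed using (_∣_; _∣?_; divides; ∣-trans; ∣⇒∣ᵤ)
  open import Data.List using (upTo)
  open import Data.Product using (_,_)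
  open import Data.Sum using (_⊎_; inj₁; inj₂)
  import Data.Sum as Sum
  open import Relation.Nullary using (¬_; yes; no)
  open import Relation.Binary.PropositionalEquality as ≡ using (_≡_; _≢_)
  open Arithmetic using (p^k∣q-1∨q+1∨q[q-1]⇒p^k≤q)
  open QuadraticAlgebra t m using (conj; ι; Δ; ι·-pair; ι·ι; δ·δ≡ιΔ; ι2·w≡α+βδ; ι2·w̄≡α-βδ; module Modulo)
  open Modulo (suc (r ℕ.+ r)) using (commutativeRing; _≋,≋_; proj₁≋; proj₂≋; ≈-reflexive)
  open IntegerCongruence (suc (r ℕ.+ r))
  open CommutativeRing commutativeRing
  open import Algebra.Properties.Semiring.Exp semiring
  open import Algebra.Properties.Semiring.Mult semiring using (_×_)
  open PrimeCharacteristic commutativeRing using (module Characteristic)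
  open NormOneFrobenius commutativeRing using (norm-one-order; frobenius-square-root-cases)
  open PowerSums semiring using (powerSum; cyclotomic-root⇒prime-power∣exponent)
  open import Relation.Binary.Reasoning.Setoid setoid

  q : ℕ
  q = suc (r ℕ.+ r)

  ι-cong : ∀ {c d} → c ≋ d → ι c ≈ ι d
  ι-cong c≋d = c≋d ≋,≋ ≋-refl

  ι-^ : ∀ c k → ι c ^ k ≈ ι (c ℤ.^ k)
  ι-^ c ℕ.zero    = refl
  ι-^ c (suc k) = begin
    ι c * ι c ^ k        ≈⟨ *-congˡ {x = ι c} (ι-^ c k) ⟩
    ι c * ι (c ℤ.^ k)    ≈⟨ ≈-reflexive (ι·ι c (c ℤ.^ k)) ⟩
    ι (c ℤ.^ suc k)      ∎

  ι-×1# : ∀ n → n × 1# ≈ ι (+ n)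
  ι-×1# ℕ.zero    = refl
  ι-×1# (suc n) = begin
    1# + n × 1#    ≈⟨ +-congˡ {x = 1#} (ι-×1# n) ⟩
    1# + ι (+ n)   ≡⟨⟩
    ι (+ suc n)    ∎

  q×1#≈0# : q × 1# ≈ 0#
  q×1#≈0# = trans (ι-×1# q) (ι-cong (∣⇒≋0 (divides (+ 1) (≡.sym (ℤₚ.*-identityˡ (+ q))))))

  open Characteristic q-prime q×1#≈0#

  ι-fermat : ∀ c → ι c ^ q ≈ ι c
  ι-fermat (+ n) = begin
    ι (+ n) ^ q     ≈⟨ ^-congˡ q (ι-×1# n) ⟨
    (n × 1#) ^ q    ≈⟨ fermat n ⟩
    n × 1#          ≈⟨ ι-×1# n ⟩
    ι (+ n)         ∎
  ι-fermat -[1+ n ] = begin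
    ι -[1+ n ] ^ q            ≡⟨⟩
    (- ι (+ suc n)) ^ q       ≈⟨ -‿^q (ι (+ suc n)) ⟩
    - (ι (+ suc n) ^ q)       ≈⟨ -‿cong (ι-fermat (+ suc n)) ⟩
    - ι (+ suc n)             ∎

  fermat-ℤ : ∀ c → c ℤ.^ q ≋ c
  fermat-ℤ c = proj₁≋ (trans (sym (ι-^ c q)) (ι-fermat c))

  private
    r≢0 : r ≢ 0
    r≢0 ≡.refl = ¬prime[1] q-prime

  euler-criterion : ∀ c → c ℤ.^ r ≋ + 1 ⊎ c ℤ.^ r ≋ ℤ.- + 1 ⊎ c ℤ.^ r ≋ + 0
  euler-criterion c with + q ∣? c
  ... | yes q∣c = inj₂ (inj₂ (∣⇒≋0 (∣-trans q∣c c∣cʳ)))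
    where
    c∣cʳ : c ∣ c ℤ.^ r
    c∣cʳ = divides (c ℤ.^ ℕ.pred r) (≡.trans
      (≡.cong (c ℤ.^_) (≡.sym (ℕₚ.suc-pred r {{≢-nonZero r≢0}})))
      (ℤₚ.*-comm c (c ℤ.^ ℕ.pred r)))
  ... | no  q∤c = Sum.map₂ inj₁ (z²≋1⇒z≋±1 q-prime (*-cancelˡ-≋ q-prime q∤c c[cʳcʳ]≋c1))
    where
    c[cʳcʳ]≋c1 : c ℤ.* (c ℤ.^ r ℤ.* c ℤ.^ r) ≋ c ℤ.* + 1
    c[cʳcʳ]≋c1 = ≋-trans (≋-reflexive (≡.cong (c ℤ.*_) (≡.sym (ℤₚ.^-distribˡ-+-* c r r))))
                   (≋-trans (fermat-ℤ c) (≋-reflexive (≡.sym (ℤₚ.*-identityʳ c))))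

  ι-cancelˡ : ∀ {c x y} → ¬ (+ q ∣ c) → ι c * x ≈ ι c * y → x ≈ y
  ι-cancelˡ {c} {a , b} {a′ , b′} q∤c ιcx≈ιcy =
    *-cancelˡ-≋ q-prime q∤c (proj₁≋ cx≈cy) ≋,≋ *-cancelˡ-≋ q-prime q∤c (proj₂≋ cx≈cy)
    where
    cx≈cy : (c ℤ.* a , c ℤ.* b) ≈ (c ℤ.* a′ , c ℤ.* b′)
    cx≈cy = ≡.subst₂ _≈_ (ι·-pair c a b) (ι·-pair c a′ b′) ιcx≈ιcy

  q∤2 : ¬ (+ q ∣ + 2)
  q∤2 q∣2 = ℕₚ.<⇒≱ 2<q (∣⇒≤ (∣⇒∣ᵤ q∣2))
    where
    1≤r : 1 ℕ.≤ r
    1≤r = ℕₚ.n≢0⇒n>0 r≢0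
    2<q : 2 ℕ.< q
    2<q = s≤s (ℕₚ.+-mono-≤ 1≤r 1≤r)

  ιΔ-euler : ι Δ ^ r ≈ 1# ⊎ ι Δ ^ r ≈ - 1# ⊎ ι Δ ^ r ≈ 0#
  ιΔ-euler = Sum.map lift (Sum.map lift lift) (euler-criterion Δ)
    where
    lift : ∀ {c} → Δ ℤ.^ r ≋ c → ι Δ ^ r ≈ ι c
    lift Δʳ≋c = trans (ι-^ Δ r) (ι-cong Δʳ≋c)

  norm-one⇒order : ∀ {w} → w * conj w ≈ 1# →
    w ^ (r ℕ.+ r) ≈ 1# ⊎ w ^ suc q ≈ 1# ⊎ w ^ (q ℕ.* (r ℕ.+ r)) ≈ 1#
  norm-one⇒order {a , b} ww̄≈1 =
    norm-one-order {r = r} q-prime q×1#≈0# (ι-cancelˡ q∤2)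
      (ι-fermat (+ 2)) (ι-fermat (+ 2 ℤ.* a ℤ.+ t ℤ.* b)) (ι-fermat b)
      (≈-reflexive (ι2·w≡α+βδ a b)) (≈-reflexive (ι2·w̄≡α-βδ a b)) ww̄≈1
      (frobenius-square-root-cases r (≈-reflexive δ·δ≡ιΔ) ιΔ-euler)

  p×1#≉0# : ∀ {p} → Prime p → p ≢ q → p × 1# ≉ 0#
  p×1#≉0# {p} p-prime p≢q p×1#≈0#
    with prime⇒irreducible p-prime (∣⇒∣ᵤ (≋0⇒∣ (proj₁≋ (trans (sym (ι-×1# p)) p×1#≈0#))))
  ... | inj₁ q≡1 = ¬prime[1] (≡.subst Prime q≡1 q-prime)
  ... | inj₂ q≡p = p≢q (≡.sym q≡p)

  cyclotomic-root⇒p^j≤q : ∀ {w p} h j → Prime p → p ≢ 2 → p ≢ q → w * conj w ≈ 1# →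
    powerSum (w ^ (h ℕ.* p ℕ.^ j)) (upTo p) ≈ 0# → p ℕ.^ suc j ℕ.≤ q
  cyclotomic-root⇒p^j≤q {w} {p} h j p-prime p≢2 p≢q ww̄≈1 Φ≈0 =
    p^k∣q-1∨q+1∨q[q-1]⇒p^k≤q {r = r} {k = suc j} p-prime q-prime p≢2 p≢q
      (Sum.map p^[1+j]∣ (Sum.map p^[1+j]∣ p^[1+j]∣) (norm-one⇒order ww̄≈1))
    where
    p^[1+j]∣ : ∀ {E} → w ^ E ≈ 1# → p ℕ.^ suc j ℕ∣ E
    p^[1+j]∣ = cyclotomic-root⇒prime-power∣exponent {x = w} {h = h} {j = j}
                 p-prime (p×1#≉0# p-prime p≢q) Φ≈0

module Encoding where
  open import Data.Nat using (suc)
  open import Data.Integer as ℤ using (+_; _+_; _-_; _*_; -_; _/_; _%_; _/ℕ_)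
  import Data.Integer.Properties as ℤₚ
  open import Data.Integer.DivMod using (a≡a%n+[a/n]*n; div-pos-is-/ℕ; [n/ℕd]*d≤n; n<s[n/ℕd]*d)
  open import Data.Integer.Tactic.RingSolver using (solve)
  open import Data.List using ([]; _∷_; upTo)
  open import Data.List.Properties using (foldr-cong)
  open import Data.Product using (_,_)
  open import Relation.Binary.PropositionalEquality
  open import Data.Nat.Divisibility using () renaming (_∣_ to _ℕ∣_)
  open import Defs using (QElt; addQ; oneQ; mulQ; normQ; powQ; cyclotomicQ; InG; _≡Q_[mod_])

  [i*4]/4≡i : ∀ i → (i * + 4) / + 4 ≡ i
  [i*4]/4≡i i = trans (div-pos-is-/ℕ (i * + 4) 4) (ℤₚ.≤-antisym ⌊i*4/4⌋≤i i≤⌊i*4/4⌋)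
    where
    ⌊i*4/4⌋ : ℤ
    ⌊i*4/4⌋ = (i * + 4) /ℕ 4
    ⌊i*4/4⌋≤i : ⌊i*4/4⌋ ℤ.≤ i
    ⌊i*4/4⌋≤i = ℤₚ.*-cancelʳ-≤-pos _ i (+ 4) ([n/ℕd]*d≤n (i * + 4) 4)
    i≤⌊i*4/4⌋ : i ℤ.≤ ⌊i*4/4⌋
    i≤⌊i*4/4⌋ = subst (i ℤ.≤_) (ℤₚ.pred-suc ⌊i*4/4⌋) (ℤₚ.i<j⇒i≤pred[j]
                  (ℤₚ.*-cancelʳ-<-nonNeg {i} {ℤ.suc ⌊i*4/4⌋} (+ 4) (n<s[n/ℕd]*d (i * + 4) 4)))

  -- θ² = θ-trace D · θ + θ-const D, matching the two cases of mulQ.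
  θ-trace θ-const : ℤ → ℤ
  θ-trace D with D % + 4
  ... | 1 = + 1
  ... | _ = + 0
  θ-const D with D % + 4
  ... | 1 = (D - + 1) / + 4
  ... | _ = D

  private
    coeff₁[t≡0] : ∀ a b c d → a * d + b * c ≡ a * d + b * c + + 0 * (b * d)
    coeff₁[t≡0] a b c d = solve (a ∷ b ∷ c ∷ d ∷ [])
    norm-coeff₀[t≡1] : ∀ a b k → a * (a + + 1 * b) + k * (b * - b) ≡ a * a + a * b + (- k) * (b * b)
    norm-coeff₀[t≡1] a b k = solve (a ∷ b ∷ k ∷ [])
    norm-coeff₀[t≡0] : ∀ a b D → a * (a + + 0 * b) + D * (b * - b) ≡ a * a - D * (b * b)
    norm-coeff₀[t≡0] a b D = solve (a ∷ b ∷ D ∷ [])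
    norm-coeff₁ : ∀ a b t → a * - b + b * (a + t * b) + t * (b * - b) ≡ + 0
    norm-coeff₁ a b t = solve (a ∷ b ∷ t ∷ [])
    1+k*4-1≡k*4 : ∀ k → (+ 1 + k * + 4) - + 1 ≡ k * + 4
    1+k*4-1≡k*4 k = solve (k ∷ [])
    1-[1+k*4]≡-k*4 : ∀ k → + 1 - (+ 1 + k * + 4) ≡ (- k) * + 4
    1-[1+k*4]≡-k*4 k = solve (k ∷ [])

  module _ (D : ℤ) where
    open QuadraticAlgebra (θ-trace D) (θ-const D)

    -- Three cases, as the catch-all clause of mulQ only computes once D % 4 is seen to differ from 1.
    mulQ≡· : ∀ x y → mulQ D x y ≡ x · y
    mulQ≡· (a , b) (c , d) with D % + 4
    ... | 1           = cong₂ _,_ refl coeff₁[t≡1]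
      where
      coeff₁[t≡1] : a * d + b * c + b * d ≡ a * d + b * c + + 1 * (b * d)
      coeff₁[t≡1] = solve (a ∷ b ∷ c ∷ d ∷ [])
    ... | 0           = cong₂ _,_ refl (coeff₁[t≡0] a b c d)
    ... | suc (suc _) = cong₂ _,_ refl (coeff₁[t≡0] a b c d)

    ·-conj≡normQ : ∀ w → w · conj w ≡ (normQ D w , + 0)
    ·-conj≡normQ (a , b) with D % + 4 in D%4≡
    ... | 1 = cong₂ _,_ coeff₀ (norm-coeff₁ a b (+ 1))
      where
      k : ℤ
      k = D / + 4
      D≡1+k*4 : D ≡ + 1 + k * + 4
      D≡1+k*4 = trans (a≡a%n+[a/n]*n D (+ 4)) (cong (λ r → + r + k * + 4) D%4≡)
      [D-1]/4≡k : (D - + 1) / + 4 ≡ k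
      [D-1]/4≡k = trans (cong (λ x → (x - + 1) / + 4) D≡1+k*4)
                    (trans (cong (_/ + 4) (1+k*4-1≡k*4 k)) ([i*4]/4≡i k))
      [1-D]/4≡-k : (+ 1 - D) / + 4 ≡ - k
      [1-D]/4≡-k = trans (cong (λ x → (+ 1 - x) / + 4) D≡1+k*4)
                     (trans (cong (_/ + 4) (1-[1+k*4]≡-k*4 k)) ([i*4]/4≡i (- k)))
      coeff₀ : a * (a + + 1 * b) + (D - + 1) / + 4 * (b * - b) ≡
               a * a + a * b + (+ 1 - D) / + 4 * (b * b)
      coeff₀ = subst₂ (λ x y → a * (a + + 1 * b) + x * (b * - b) ≡ a * a + a * b + y * (b * b))
               (sym [D-1]/4≡k) (sym [1-D]/4≡-k) (norm-coeff₀[t≡1] a b k)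
    ... | 0           = cong₂ _,_ (norm-coeff₀[t≡0] a b D) (norm-coeff₁ a b (+ 0))
    ... | suc (suc _) = cong₂ _,_ (norm-coeff₀[t≡0] a b D) (norm-coeff₁ a b (+ 0))

    module _ (n : ℕ) where
      open Modulo n using (commutativeRing)
      open CommutativeRing commutativeRing using (semiring)
      open import Algebra.Properties.Semiring.Exp semiring using (_^_)
      open PowerSums semiring using (powerSum)

      powQ≡^ : ∀ x k → powQ D x k ≡ x ^ k
      powQ≡^ x ℕ.zero  = refl
      powQ≡^ x (suc k) = trans (mulQ≡· x (powQ D x k)) (cong (x ·_) (powQ≡^ x k))

      cyclotomicQ≡powerSum : ∀ p x → cyclotomicQ D p x ≡ powerSum x (upTo p)
      cyclotomicQ≡powerSum p x = foldr-cong (λ i s → cong (λ y → addQ y s) (powQ≡^ x i)) refl (upTo p)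

      module _ {N : ℕ} (n∣N : n ℕ∣ N) where
        open Modulo n using (_≈_; _≋,≋_)
        open IntegerCongruence n using (≡[mod]⇒≋; ≋-refl)

        InG⇒norm-one : ∀ {w} → InG N D w → w · conj w ≈ oneQ
        InG⇒norm-one {w} w∈G = subst (_≈ oneQ) (sym (·-conj≡normQ w)) (≡[mod]⇒≋ n∣N w∈G ≋,≋ ≋-refl)

        cyclotomic-root : ∀ {p w k} → cyclotomicQ D p (powQ D w k) ≡Q (+ 0 , + 0) [mod N ] →
                          powerSum (w ^ k) (upTo p) ≈ zeroQ
        cyclotomic-root {p} {w} {k} (Φ₁≡0 , Φ₂≡0) =
          subst (_≈ zeroQ)
            (trans (cyclotomicQ≡powerSum p (powQ D w k)) (cong (λ x → powerSum x (upTo p)) (powQ≡^ w k)))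
            (≡[mod]⇒≋ n∣N Φ₁≡0 ≋,≋ ≡[mod]⇒≋ n∣N Φ₂≡0)

open import Defs
open import Data.Nat using (ℕ; _*_; _^_; _∸_; _≤_; _%_)
open import Data.Nat.GCD using (gcd)
open import Data.Nat.Primality using (Prime)
open import Data.Integer using (ℤ; +_; -_)
open import Data.Product using (Σ; _×_; _,_)
open import Relation.Binary.PropositionalEquality using (_≡_; _≢_)

open import Data.Nat using (suc; _+_; _/_; _<_; n>1⇒nonTrivial)
open import Data.Nat.Properties
  using (+-comm; *-identityʳ; m∸n+n≡m; *-mono-≤; m^n>0; ≤∧≢⇒<; <-≤-trans; n<1+n; ≤-pred)
open import Data.Nat.Divisibility
  using (_∣_; _∤_; ∣-trans; n∣m*n; ∣m+n∣m⇒∣n; ∣1⇒≡1; ∣⇒≤; ∣-reflexive)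
open import Data.Nat.Primality using (¬prime[1]; prime⇒nonZero; rough∧square>⇒prime)
open import Relation.Binary.PropositionalEquality using (sym; trans; cong; subst)
open import Function using (_∘_)
open Arithmetic
  using (prime>1; ^-monoʳ-∣; m^[2*n]≡m^n*m^n; odd⇒≢2; odd⇒≡1+[n/2+n/2]; ∣odd⇒odd; primes≥⇒rough)
open Encoding using (θ-trace; θ-const; InG⇒norm-one; cyclotomic-root)

odd-prime-divisor-bound : ∀ D {N p q h j} (w : QElt) → Prime p → p ≢ 2 → p ∤ N →
  Prime q → q ∣ N → q % 2 ≡ 1 → InG N D w →
  cyclotomicQ D p (powQ D w (h * p ^ j)) ≡Q (+ 0 , + 0) [mod N ] → p ^ suc j ≤ q
odd-prime-divisor-bound D {N} {p} {q} {h} {j} w p-prime p≢2 p∤N q-prime q∣N q-odd w∈G Φ≡0 =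
  subst (p ^ suc j ≤_) (sym q≡q′)
    (cyclotomic-root⇒p^j≤q {w = w} h j p-prime p≢2 (p∤N ∘ λ p≡q → subst (_∣ N) (sym p≡q) q∣N′)
      (InG⇒norm-one D q′ q∣N′ {w = w} w∈G) (cyclotomic-root D q′ q∣N′ {p = p} {w = w} {k = h * p ^ j} Φ≡0))
  where
  q′ : ℕ
  q′ = suc (q / 2 + q / 2)
  q≡q′ : q ≡ q′
  q≡q′ = odd⇒≡1+[n/2+n/2] q-odd
  q∣N′ : q′ ∣ N
  q∣N′ = subst (_∣ N) q≡q′ q∣N
  open QuadraticAlgebraModPrime (θ-trace D) (θ-const D) (q / 2) (subst Prime q≡q′ q-prime)
    using (cyclotomic-root⇒p^j≤q)

module ArithmeticOfN {p k ℓ c N : ℕ} (p-prime : Prime p) (1≤k : 1 ≤ k) (1≤ℓ : 1 ≤ ℓ) (1≤c : 1 ≤ c)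
                     (N≡ckpˡ∸1 : N ≡ c * k * p ^ ℓ ∸ 1) where

  1+N≡ckpˡ : suc N ≡ c * k * p ^ ℓ
  1+N≡ckpˡ = trans (cong suc N≡ckpˡ∸1) (trans (+-comm 1 _) (m∸n+n≡m 1≤ckpˡ))
    where
    1≤ckpˡ : 1 ≤ c * k * p ^ ℓ
    1≤ckpˡ = *-mono-≤ (*-mono-≤ 1≤c 1≤k) (m^n>0 p {{prime⇒nonZero p-prime}} ℓ)

  p∣1+N : p ∣ suc N
  p∣1+N = subst (p ∣_) (sym 1+N≡ckpˡ) (∣-trans p∣pˡ (n∣m*n (c * k)))
    where
    p∣pˡ : p ∣ p ^ ℓ
    p∣pˡ = ∣-trans (∣-reflexive (sym (*-identityʳ p))) (^-monoʳ-∣ p 1≤ℓ)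

  p∤N : p ∤ N
  p∤N p∣N = ¬prime[1] (subst Prime (∣1⇒≡1 (∣m+n∣m⇒∣n (subst (p ∣_) (+-comm 1 N) p∣1+N) p∣N)) p-prime)

  N<ckpˡ : N < c * k * p ^ ℓ
  N<ckpˡ = subst (N <_) 1+N≡ckpˡ (n<1+n N)

  2≤N : p % 2 ≡ 1 → 2 ≤ N
  2≤N p-odd = ≤-pred (<-≤-trans (≤∧≢⇒< (prime>1 p-prime) (odd⇒≢2 p-odd ∘ sym)) (∣⇒≤ p∣1+N))

theorem1p2 : (D : ℤ) → SquareFree D → D ≢ + 1 →
  (p k ℓ c : ℕ) → Prime p → p % 2 ≡ 1 → 1 ≤ k → 1 ≤ ℓ → 1 ≤ c →
  gcd (c * k) p ≡ 1 →
  (N : ℕ) → N ≡ c * k * p ^ ℓ ∸ 1 →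
  N % 2 ≡ 1 → JacobiIs D N (- (+ 1)) →
  (w : QElt) → InG N D w →
  Σ ℕ (λ j → (1 ≤ j) × (j ≤ ℓ) ×
    (cyclotomicQ D p (powQ D w (c * k * p ^ (j ∸ 1))) ≡Q (+ 0 , + 0) [mod N ]) ×
    (c * k * p ^ ℓ ≤ p ^ (2 * j))) →
  Prime N
theorem1p2 _ _ _ _ _ _ _ _ _ _ _ _ _ _ _ _ _ _ _ (ℕ.zero , () , _)
theorem1p2 D _ _ p k ℓ c p-prime p-odd 1≤k 1≤ℓ 1≤c _ N N≡ N-odd _ w w∈G (suc j , _ , _ , Φ≡0 , ckpˡ≤p²ʲ) =
  rough∧square>⇒prime {{n>1⇒nonTrivial (2≤N p-odd)}} (primes≥⇒rough (p ^ suc j) prime-divisor≥pʲ) N<pʲpʲ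
  where
  open ArithmeticOfN p-prime 1≤k 1≤ℓ 1≤c N≡
  prime-divisor≥pʲ : ∀ {q} → Prime q → q ∣ N → p ^ suc j ≤ q
  prime-divisor≥pʲ q-prime q∣N =
    odd-prime-divisor-bound D {h = c * k} {j} w p-prime (odd⇒≢2 p-odd) p∤N
      q-prime q∣N (∣odd⇒odd q∣N N-odd) w∈G Φ≡0
  N<pʲpʲ : N < p ^ suc j * p ^ suc j
  N<pʲpʲ = <-≤-trans N<ckpˡ (subst (c * k * p ^ ℓ ≤_) (m^[2*n]≡m^n*m^n p (suc j)) ckpˡ≤p²ʲ)
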